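{- For every $n\ge 1$ and $k\ge 0$, the $w_r$-weight $u(n,k,s,r)$ of the set of all tilings of the $n$-board with exactly $k$ dominoes is $$u(n,k,s,r)=q^{k^2}\begin{bmatrix} n-k\\ k\end{bmatrix}\prod_{i=k+1}^{n-k}(1+q^{i}r)\; s^kx^{n-2k}$$ for $0\le k\le\lfloor n/2\rfloor$, and $u(n,k,s,r)=0$ for $k>\lfloor n/2\rfloor$.
   Context: Let $q$ be a real number with $q\neq -1$ and $r$ a parameter. Let $[m]=1+q+\dots+q^{m-1}$, $[m]!=[1]\cdots[m]$, and $\begin{bmatrix} m\\ j\end{bmatrix}=\frac{[m]!}{[j]![m-j]!}$ for $0\le j\le m$. The $n$-board consists of cells numbered $1,\dots,n$. A tiling of it is a covering of all cells by non-overlapping tiles, each tile being a white square (one cell), a black square (one cell), or a domino (two adjacent cells $i-1,i$). The weight $w_r$: a white square has weight $x$; a black square at position $i$ has weight $q^irx$; a domino covering positions $i-1,i$ has weight $q^{i-1}s$; the weight of a tiling is the product of the weights of its tiles, and of a set of tilings the sum of the weights of its elements. An empty product equals $1$. -}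

module Defs where

open import Level using (Level)
open import Data.Nat using (ℕ; zero; suc; _∸_)
open import Data.List using (List; []; _∷_; _++_; map; filter; foldr)
open import Data.Nat using (_≟_)
open import Data.Product using (proj₁)
open import Algebra.Apartness.Bundles using (HeytingField)

data Tile : Set where
  white black domino : Tile

-- A tiling of the n-board, built left to right: t ▷ w appends tile w at the right end.
-- A white/black square occupies one cell, a domino two adjacent cells.
data Tiling : ℕ → Set where
  empty   : Tiling 0
  _▷white  : ∀ {n} → Tiling n → Tiling (suc n)
  _▷black  : ∀ {n} → Tiling n → Tiling (suc n)
  _▷domino : ∀ {n} → Tiling n → Tiling (suc (suc n))

dominoes : ∀ {n} → Tiling n → ℕ
dominoes empty        = 0
dominoes (t ▷white)   = dominoes t
dominoes (t ▷black)   = dominoes t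
dominoes (t ▷domino)  = suc (dominoes t)

tilings : (n : ℕ) → List (Tiling n)
tilings zero          = empty ∷ []
tilings (suc zero)    = map _▷white (tilings 0) ++ map _▷black (tilings 0)
tilings (suc (suc n)) = map _▷white (tilings (suc n)) ++ map _▷black (tilings (suc n))
                        ++ map _▷domino (tilings n)

tilingsWith : (n k : ℕ) → List (Tiling n)
tilingsWith n k = filter (λ t → dominoes t ≟ k) (tilings n)

module _ {c ℓ₁ ℓ₂ : Level} (F : HeytingField c ℓ₁ ℓ₂) where
  open HeytingField F

  pow : Carrier → ℕ → Carrier
  pow a zero    = 1#
  pow a (suc m) = a * pow a m

  qint : Carrier → ℕ → Carrier
  qint q zero    = 0#
  qint q (suc m) = qint q m + pow q m

  qfact : Carrier → ℕ → Carrier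
  qfact q zero    = 1#
  qfact q (suc m) = qfact q m * qint q (suc m)

  -- the weight w_r of a tiling of the n-board:
  -- white square: x; black square at position i: q^i r x; domino on (i-1,i): q^(i-1) s.
  weight : (q r s x : Carrier) → ∀ {n} → Tiling n → Carrier
  weight q r s x empty                 = 1#
  weight q r s x (_▷white {n} t)       = weight q r s x t * x
  weight q r s x (_▷black {n} t)       = weight q r s x t * (pow q (suc n) * r * x)
  weight q r s x (_▷domino {n} t)      = weight q r s x t * (pow q (suc n) * s)

  weightSum : (q r s x : Carrier) → ∀ {n} → List (Tiling n) → Carrier
  weightSum q r s x = foldr (λ t acc → weight q r s x t + acc) 0#

  u : (q r s x : Carrier) → (n k : ℕ) → Carrier
  u q r s x n k = weightSum q r s x (tilingsWith n k)

  module _ (q : Carrier) (nz : ∀ m → qint q (suc m) # 0#) where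

    qintInv : ℕ → Carrier
    qintInv m = proj₁ (#⇒invertible (nz m))   -- inverse of [m+1] (- 0)

    qfactInv : ℕ → Carrier
    qfactInv zero    = 1#
    qfactInv (suc m) = qfactInv m * qintInv m

    -- q-binomial coefficient [m choose j] = [m]! / ([j]! [m-j]!)  (used for j ≤ m)
    qbinom : ℕ → ℕ → Carrier
    qbinom m j = qfact q m * (qfactInv j * qfactInv (m ∸ j))

  prodFrom : (ℕ → Carrier) → ℕ → ℕ → Carrier
  prodFrom f a zero      = 1#
  prodFrom f a (suc len) = f a * prodFrom f (suc a) len

-- Classifying tilings by their last tile gives u(n+1,0) = u(n,0)(x + q^(n+1) r x) and
-- u(n+2,k+1) = u(n+1,k+1)(x + q^(n+2) r x) + u(n,k) q^(n+1) s, with u(n,k) = 0 for n < 2k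
-- because a domino covers two cells. Writing n = 2k + d, the closed form satisfies the same
-- recurrence: after dividing out the common factors this is the identity
-- [K+D choose K](1 + q^(K+D) r) = [K+d choose K](1 + q^(2K+D) r) + q^D [k+D choose k](1 + q^K r)
-- (K = k+1, D = d+1), which is the sum of the two q-Pascal rules, one of them scaled by q^(K+D) r.
module Submission where

open import Defs
open import Data.Nat using (ℕ; suc; _∸_; _≤_; _<_; ⌊_/2⌋)
import Data.Nat as ℕ
open import Data.Product using (_×_)
open import Algebra.Apartness.Bundles using (HeytingField)

open import Algebra.Apartness.Bundles using (HeytingCommutativeRing)
open import Data.Nat using (zero; s≤s)
import Data.Nat.Properties as ℕₚ
open import Data.Nat.Solver using (module +-*-Solver)
open import Data.Product using (_,_; proj₂)
open import Data.Bool using (true; false)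
open import Data.List using (List; []; _∷_; _++_; map; filter)
open import Data.List.Properties using (filter-++; filter-≐; filter-none; ++-identityʳ)
import Data.List.Relation.Unary.All as All
open import Function using (_∘_)
open import Relation.Nullary using (does)
open import Relation.Unary using (Pred; Decidable)
open import Relation.Binary.PropositionalEquality as ≡
  using (_≡_; refl; cong; cong₂; subst)
open import Algebra.Bundles using (CommutativeRing)
import Algebra.Apartness.Properties.HeytingCommutativeRing as HeytingProperties

k≤⌊n/2⌋⇒k+k≤n : ∀ {n k} → k ≤ ⌊ n /2⌋ → k ℕ.+ k ≤ n
k≤⌊n/2⌋⇒k+k≤n {n} k≤ = ℕₚ.≤-trans (ℕₚ.+-mono-≤ k≤ (ℕₚ.≤-trans k≤ (ℕₚ.⌊n/2⌋≤⌈n/2⌉ n)))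
                                 (ℕₚ.≤-reflexive (ℕₚ.⌊n/2⌋+⌈n/2⌉≡n n))

⌊n/2⌋<k⇒n<k+k : ∀ {n k} → ⌊ n /2⌋ < k → n < k ℕ.+ k
⌊n/2⌋<k⇒n<k+k {n} {k} ⌊n/2⌋<k = ℕₚ.≰⇒> λ k+k≤n →
  ℕₚ.<⇒≱ ⌊n/2⌋<k (subst (_≤ ⌊ n /2⌋) (≡.sym (ℕₚ.n≡⌊n+n/2⌋ k)) (ℕₚ.⌊n/2⌋-mono k+k≤n))

suc-k+suc-k+d : ∀ k d → suc k ℕ.+ suc k ℕ.+ d ≡ suc (suc (k ℕ.+ k ℕ.+ d))
suc-k+suc-k+d k d = cong (λ m → suc (m ℕ.+ d)) (ℕₚ.+-suc k k)

suc-k*suc-k : ∀ k → suc k ℕ.* suc k ≡ k ℕ.* k ℕ.+ suc (k ℕ.+ k)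
suc-k*suc-k = solve 1 (λ k → (con 1 :+ k) :* (con 1 :+ k) := k :* k :+ (con 1 :+ (k :+ k))) refl
  where open +-*-Solver

filter-map : ∀ {a b p} {A : Set a} {B : Set b} {P : Pred B p} (P? : Decidable P) (f : A → B) xs →
             filter P? (map f xs) ≡ map f (filter (P? ∘ f) xs)
filter-map P? f [] = refl
filter-map P? f (x ∷ xs) with does (P? (f x))
... | true  = cong (f x ∷_) (filter-map P? f xs)
... | false = filter-map P? f xs

dominoes+dominoes≤n : ∀ {n} (t : Tiling n) → dominoes t ℕ.+ dominoes t ≤ n
dominoes+dominoes≤n empty      = ℕ.z≤n
dominoes+dominoes≤n (t ▷white) = ℕₚ.m≤n⇒m≤1+n (dominoes+dominoes≤n t)
dominoes+dominoes≤n (t ▷black) = ℕₚ.m≤n⇒m≤1+n (dominoes+dominoes≤n t)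
dominoes+dominoes≤n (t ▷domino) rewrite ℕₚ.+-suc (dominoes t) (dominoes t) =
  s≤s (s≤s (dominoes+dominoes≤n t))

tilingsWith-empty : ∀ {n k} → n < k ℕ.+ k → tilingsWith n k ≡ []
tilingsWith-empty {n} {k} n<k+k = filter-none (λ t → dominoes t ℕ.≟ k)
  (All.universal (λ t d≡k → ℕₚ.<⇒≱ n<k+k (subst (λ j → j ℕ.+ j ≤ n) d≡k (dominoes+dominoes≤n t)))
                 (tilings n))

tilingsWith-suc-zero : ∀ n → tilingsWith (suc n) 0 ≡ map _▷white (tilingsWith n 0) ++ map _▷black (tilingsWith n 0)
tilingsWith-suc-zero zero = refl
tilingsWith-suc-zero (suc n) = begin
  filter P (map _▷white T ++ map _▷black T ++ map _▷domino (tilings n))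
    ≡⟨ filter-++ P (map _▷white T) _ ⟩
  filter P (map _▷white T) ++ filter P (map _▷black T ++ map _▷domino (tilings n))
    ≡⟨ cong (filter P (map _▷white T) ++_) (filter-++ P (map _▷black T) _) ⟩
  filter P (map _▷white T) ++ filter P (map _▷black T) ++ filter P (map _▷domino (tilings n))
    ≡⟨ cong₂ _++_ (filter-map P _▷white T) (cong₂ _++_ (filter-map P _▷black T) noDominoTiling) ⟩
  map _▷white (filter P T) ++ map _▷black (filter P T) ++ []
    ≡⟨ cong (map _▷white (filter P T) ++_) (++-identityʳ _) ⟩
  map _▷white (filter P T) ++ map _▷black (filter P T) ∎
  where
  open ≡.≡-Reasoning
  T = tilings (suc n)
  P = λ {m} (t : Tiling m) → dominoes t ℕ.≟ 0
  noDominoTiling : filter P (map _▷domino (tilings n)) ≡ []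
  noDominoTiling = ≡.trans (filter-map P _▷domino (tilings n))
    (cong (map _▷domino) (filter-none (P ∘ _▷domino) (All.universal (λ _ ()) (tilings n))))

tilingsWith-suc-suc : ∀ n k → tilingsWith (suc (suc n)) (suc k) ≡
  map _▷white (tilingsWith (suc n) (suc k)) ++ map _▷black (tilingsWith (suc n) (suc k))
    ++ map _▷domino (tilingsWith n k)
tilingsWith-suc-suc n k = begin
  filter P (map _▷white T ++ map _▷black T ++ map _▷domino (tilings n))
    ≡⟨ filter-++ P (map _▷white T) _ ⟩
  filter P (map _▷white T) ++ filter P (map _▷black T ++ map _▷domino (tilings n))
    ≡⟨ cong (filter P (map _▷white T) ++_) (filter-++ P (map _▷black T) _) ⟩
  filter P (map _▷white T) ++ filter P (map _▷black T) ++ filter P (map _▷domino (tilings n))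
    ≡⟨ cong₂ _++_ (filter-map P _▷white T) (cong₂ _++_ (filter-map P _▷black T)
         (≡.trans (filter-map P _▷domino (tilings n))
                  (cong (map _▷domino) (filter-≐ (P ∘ _▷domino) (λ t → dominoes t ℕ.≟ k)
                                                  (ℕₚ.suc-injective , cong suc) (tilings n))))) ⟩
  map _▷white (filter P T) ++ map _▷black (filter P T) ++ map _▷domino (tilingsWith n k) ∎
  where
  open ≡.≡-Reasoning
  T = tilings (suc n)
  P = λ {m} (t : Tiling m) → dominoes t ℕ.≟ suc k

module _ {c ℓ₁ ℓ₂} (F : HeytingField c ℓ₁ ℓ₂) where
  open HeytingField F renaming (refl to ≈-refl)
  open HeytingCommutativeRing heytingCommutativeRing using (commutativeRing)
  open CommutativeRing commutativeRing using (commutativeSemiring)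
  open import Algebra.Solver.Ring.NaturalCoefficients.Default commutativeSemiring
  open HeytingProperties heytingCommutativeRing using (x-0≈x)
  open import Relation.Binary.Reasoning.Setoid setoid

  *-cancelʳ-invertible : ∀ {a b t t′} → t * t′ ≈ 1# → a * t ≈ b * t → a ≈ b
  *-cancelʳ-invertible {a} {b} {t} {t′} tt′≈1 at≈bt = begin
    a             ≈⟨ sym (*-identityʳ a) ⟩
    a * 1#        ≈⟨ *-congˡ (sym tt′≈1) ⟩
    a * (t * t′)  ≈⟨ sym (*-assoc a t t′) ⟩
    a * t * t′    ≈⟨ *-congʳ at≈bt ⟩
    b * t * t′    ≈⟨ *-assoc b t t′ ⟩
    b * (t * t′)  ≈⟨ *-congˡ tt′≈1 ⟩
    b * 1#        ≈⟨ *-identityʳ b ⟩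
    b             ∎

  pow-+ : ∀ a m n → pow F a (m ℕ.+ n) ≈ pow F a m * pow F a n
  pow-+ a zero    n = sym (*-identityˡ _)
  pow-+ a (suc m) n = trans (*-congˡ (pow-+ a m n)) (sym (*-assoc _ _ _))

  pow-suc-square : ∀ a k → pow F a (suc k ℕ.* suc k) ≈ pow F a (k ℕ.* k) * pow F a (suc (k ℕ.+ k))
  pow-suc-square a k = trans (reflexive (cong (pow F a) (suc-k*suc-k k))) (pow-+ a (k ℕ.* k) _)

  prodFrom-snoc : ∀ g a len → prodFrom F g a (suc len) ≈ prodFrom F g a len * g (a ℕ.+ len)
  prodFrom-snoc g a zero rewrite ℕₚ.+-identityʳ a = *-comm _ _
  prodFrom-snoc g a (suc len) rewrite ℕₚ.+-suc a len =
    trans (*-congˡ (prodFrom-snoc g (suc a) len)) (sym (*-assoc _ _ _))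

  module _ (q : Carrier) where

    [_] : ℕ → Carrier
    [ m ] = qint F q m

    [_]! : ℕ → Carrier
    [ m ]! = qfact F q m

    qint-+ : ∀ m n → [ m ℕ.+ n ] ≈ [ m ] + pow F q m * [ n ]
    qint-+ m zero rewrite ℕₚ.+-identityʳ m = sym (trans (+-congˡ (zeroʳ _)) (+-identityʳ _))
    qint-+ m (suc n) rewrite ℕₚ.+-suc m n =
      trans (+-cong (qint-+ m n) (pow-+ q m n))
            (solve 4 (λ a p b p′ → a :+ p :* b :+ p :* p′ := a :+ p :* (b :+ p′)) ≈-refl _ _ _ _)

    module _ (r s x : Carrier) where

      weightSum-++ : ∀ {n} (ts us : List (Tiling n)) →
        weightSum F q r s x (ts ++ us) ≈ weightSum F q r s x ts + weightSum F q r s x us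
      weightSum-++ []       us = sym (+-identityˡ _)
      weightSum-++ (t ∷ ts) us = trans (+-congˡ (weightSum-++ ts us)) (sym (+-assoc _ _ _))

      weightSum-map : ∀ {m n} (g : Tiling m → Tiling n) c →
        (∀ t → weight F q r s x (g t) ≈ weight F q r s x t * c) →
        ∀ ts → weightSum F q r s x (map g ts) ≈ weightSum F q r s x ts * c
      weightSum-map g c weight-g []       = sym (zeroˡ c)
      weightSum-map g c weight-g (t ∷ ts) =
        trans (+-cong (weight-g t) (weightSum-map g c weight-g ts)) (sym (distribʳ c _ _))

      u-suc-zero : ∀ n → u F q r s x (suc n) 0 ≈ u F q r s x n 0 * (x + pow F q (suc n) * r * x)
      u-suc-zero n = begin
        weightSum F q r s x (tilingsWith (suc n) 0)
          ≡⟨ cong (weightSum F q r s x) (tilingsWith-suc-zero n) ⟩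
        weightSum F q r s x (map _▷white T ++ map _▷black T)
          ≈⟨ weightSum-++ (map _▷white T) _ ⟩
        weightSum F q r s x (map _▷white T) + weightSum F q r s x (map _▷black T)
          ≈⟨ +-cong (weightSum-map _▷white x (λ _ → ≈-refl) T)
                    (weightSum-map _▷black _ (λ _ → ≈-refl) T) ⟩
        u F q r s x n 0 * x + u F q r s x n 0 * (pow F q (suc n) * r * x)
          ≈⟨ sym (distribˡ _ _ _) ⟩
        u F q r s x n 0 * (x + pow F q (suc n) * r * x) ∎
        where T = tilingsWith n 0

      u-suc-suc : ∀ n k → u F q r s x (suc (suc n)) (suc k) ≈
        u F q r s x (suc n) (suc k) * (x + pow F q (suc (suc n)) * r * x) + u F q r s x n k * (pow F q (suc n) * s)
      u-suc-suc n k = begin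
        weightSum F q r s x (tilingsWith (suc (suc n)) (suc k))
          ≡⟨ cong (weightSum F q r s x) (tilingsWith-suc-suc n k) ⟩
        weightSum F q r s x (map _▷white T ++ map _▷black T ++ map _▷domino T′)
          ≈⟨ trans (weightSum-++ (map _▷white T) _) (+-congˡ (weightSum-++ (map _▷black T) _)) ⟩
        weightSum F q r s x (map _▷white T)
          + (weightSum F q r s x (map _▷black T) + weightSum F q r s x (map _▷domino T′))
          ≈⟨ +-cong (weightSum-map _▷white x (λ _ → ≈-refl) T)
                    (+-cong (weightSum-map _▷black _ (λ _ → ≈-refl) T)
                            (weightSum-map _▷domino _ (λ _ → ≈-refl) T′)) ⟩
        U * x + (U * (pow F q (suc (suc n)) * r * x) + u F q r s x n k * (pow F q (suc n) * s))
          ≈⟨ solve 4 (λ U a b c → U :* a :+ (U :* b :+ c) := U :* (a :+ b) :+ c) ≈-refl U _ _ _ ⟩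
        U * (x + pow F q (suc (suc n)) * r * x) + u F q r s x n k * (pow F q (suc n) * s) ∎
        where
        T = tilingsWith (suc n) (suc k)
        T′ = tilingsWith n k
        U = u F q r s x (suc n) (suc k)

      u-vanishes : ∀ {n k} → n < k ℕ.+ k → u F q r s x n k ≈ 0#
      u-vanishes n<k+k = reflexive (cong (weightSum F q r s x) (tilingsWith-empty n<k+k))

    module _ (nz : ∀ m → [ suc m ] # 0#) where

      [_]⁻¹! : ℕ → Carrier
      [ m ]⁻¹! = qfactInv F q nz m

      [_choose_] : ℕ → ℕ → Carrier
      [ m choose j ] = qbinom F q nz m j

      qfact-inverseʳ : ∀ m → [ m ]! * [ m ]⁻¹! ≈ 1#
      qfact-inverseʳ zero    = *-identityˡ 1#
      qfact-inverseʳ (suc m) = begin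
        [ m ]! * [ suc m ] * ([ m ]⁻¹! * qintInv F q nz m)
          ≈⟨ solve 4 (λ f i f′ i′ → f :* i :* (f′ :* i′) := f :* f′ :* (i :* i′)) ≈-refl _ _ _ _ ⟩
        [ m ]! * [ m ]⁻¹! * ([ suc m ] * qintInv F q nz m)
          ≈⟨ *-cong (qfact-inverseʳ m) qint-inverseʳ ⟩
        1# * 1#
          ≈⟨ *-identityˡ 1# ⟩
        1# ∎
        where
        qint-inverseʳ : [ suc m ] * qintInv F q nz m ≈ 1#
        qint-inverseʳ = trans (*-congʳ (sym (x-0≈x _))) (proj₂ (proj₂ (#⇒invertible (nz m))))

      qfact²-inverseʳ : ∀ a b → [ a ]! * [ b ]! * ([ a ]⁻¹! * [ b ]⁻¹!) ≈ 1#
      qfact²-inverseʳ a b = begin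
        [ a ]! * [ b ]! * ([ a ]⁻¹! * [ b ]⁻¹!)
          ≈⟨ solve 4 (λ f g f′ g′ → f :* g :* (f′ :* g′) := f :* f′ :* (g :* g′)) ≈-refl _ _ _ _ ⟩
        [ a ]! * [ a ]⁻¹! * ([ b ]! * [ b ]⁻¹!)
          ≈⟨ *-cong (qfact-inverseʳ a) (qfact-inverseʳ b) ⟩
        1# * 1#
          ≈⟨ *-identityˡ 1# ⟩
        1# ∎

      qbinom-qfact : ∀ a b → [ a ℕ.+ b choose a ] * ([ a ]! * [ b ]!) ≈ [ a ℕ.+ b ]!
      qbinom-qfact a b = begin
        [ a ℕ.+ b ]! * ([ a ]⁻¹! * [ a ℕ.+ b ∸ a ]⁻¹!) * ([ a ]! * [ b ]!)
          ≡⟨ cong (λ m → [ a ℕ.+ b ]! * ([ a ]⁻¹! * [ m ]⁻¹!) * ([ a ]! * [ b ]!)) (ℕₚ.m+n∸m≡n a b) ⟩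
        [ a ℕ.+ b ]! * ([ a ]⁻¹! * [ b ]⁻¹!) * ([ a ]! * [ b ]!)
          ≈⟨ solve 3 (λ f t t′ → f :* t′ :* t := f :* (t :* t′)) ≈-refl _ ([ a ]! * [ b ]!) _ ⟩
        [ a ℕ.+ b ]! * ([ a ]! * [ b ]! * ([ a ]⁻¹! * [ b ]⁻¹!))
          ≈⟨ *-congˡ (qfact²-inverseʳ a b) ⟩
        [ a ℕ.+ b ]! * 1#
          ≈⟨ *-identityʳ _ ⟩
        [ a ℕ.+ b ]! ∎

      qbinom-zero : ∀ m → [ m choose 0 ] ≈ 1#
      qbinom-zero m = trans (*-congˡ (*-identityˡ _)) (qfact-inverseʳ m)

      qbinom-diag : ∀ m → [ m ℕ.+ 0 choose m ] ≈ 1#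
      qbinom-diag m = begin
        [ m ℕ.+ 0 ]! * ([ m ]⁻¹! * [ m ℕ.+ 0 ∸ m ]⁻¹!)
          ≡⟨ cong₂ (λ i j → [ i ]! * ([ m ]⁻¹! * [ j ]⁻¹!)) (ℕₚ.+-identityʳ m) (ℕₚ.m+n∸m≡n m 0) ⟩
        [ m ]! * ([ m ]⁻¹! * 1#)
          ≈⟨ *-congˡ (*-identityʳ _) ⟩
        [ m ]! * [ m ]⁻¹!
          ≈⟨ qfact-inverseʳ m ⟩
        1# ∎

      -- Both q-Pascal rules are instances: (c₁ , c₂) = (1 , q^(a+1)) and (q^(b+1) , 1).
      qbinom-pascal : ∀ a b c₁ c₂ → [ suc a ] * c₁ + [ suc b ] * c₂ ≈ [ suc a ℕ.+ suc b ] →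
        [ suc a ℕ.+ suc b choose suc a ] ≈ [ a ℕ.+ suc b choose a ] * c₁ + [ suc a ℕ.+ b choose suc a ] * c₂
      qbinom-pascal a b c₁ c₂ split = *-cancelʳ-invertible (qfact²-inverseʳ (suc a) (suc b)) (begin
        [ suc a ℕ.+ suc b choose suc a ] * ([ suc a ]! * [ suc b ]!)
          ≈⟨ qbinom-qfact (suc a) (suc b) ⟩
        [ a ℕ.+ suc b ]! * [ suc a ℕ.+ suc b ]
          ≈⟨ *-congˡ (sym split) ⟩
        [ a ℕ.+ suc b ]! * ([ suc a ] * c₁ + [ suc b ] * c₂)
          ≈⟨ solve 5 (λ f i c j c′ → f :* (i :* c :+ j :* c′) := f :* i :* c :+ f :* j :* c′) ≈-refl _ _ _ _ _ ⟩
        [ a ℕ.+ suc b ]! * [ suc a ] * c₁ + [ a ℕ.+ suc b ]! * [ suc b ] * c₂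
          ≡⟨ cong (λ m → [ a ℕ.+ suc b ]! * [ suc a ] * c₁ + [ m ]! * [ suc b ] * c₂) (ℕₚ.+-suc a b) ⟩
        [ a ℕ.+ suc b ]! * [ suc a ] * c₁ + [ suc a ℕ.+ b ]! * [ suc b ] * c₂
          ≈⟨ sym (+-cong (*-congʳ (*-congʳ (qbinom-qfact a (suc b))))
                         (*-congʳ (*-congʳ (qbinom-qfact (suc a) b)))) ⟩
        B₁ * ([ a ]! * [ suc b ]!) * [ suc a ] * c₁ + B₂ * ([ suc a ]! * [ b ]!) * [ suc b ] * c₂
          ≈⟨ solve 8 (λ B₁ B₂ c₁ c₂ f i g j →
                B₁ :* (f :* (g :* j)) :* i :* c₁ :+ B₂ :* (f :* i :* g) :* j :* c₂
                  := (B₁ :* c₁ :+ B₂ :* c₂) :* (f :* i :* (g :* j)))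
               ≈-refl B₁ B₂ c₁ c₂ [ a ]! [ suc a ] [ b ]! [ suc b ] ⟩
        (B₁ * c₁ + B₂ * c₂) * ([ suc a ]! * [ suc b ]!) ∎)
        where
        B₁ = [ a ℕ.+ suc b choose a ]
        B₂ = [ suc a ℕ.+ b choose suc a ]

      module _ (r s x : Carrier) where

        1+qⁱr : ℕ → Carrier
        1+qⁱr i = 1# + pow F q i * r

        closedForm : ℕ → ℕ → Carrier
        closedForm k d =
          pow F q (k ℕ.* k) * [ k ℕ.+ d choose k ] * prodFrom F 1+qⁱr (suc k) d * pow F s k * pow F x d

        closedForm-zero : ∀ d → closedForm 0 d ≈ prodFrom F 1+qⁱr 1 d * pow F x d
        closedForm-zero d = begin
          1# * [ d choose 0 ] * P * 1# * X
            ≈⟨ *-congʳ (*-congʳ (*-congʳ (*-congˡ (qbinom-zero d)))) ⟩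
          1# * 1# * P * 1# * X
            ≈⟨ solve 2 (λ P X → con 1 :* con 1 :* P :* con 1 :* X := P :* X) ≈-refl P X ⟩
          P * X ∎
          where
          P = prodFrom F 1+qⁱr 1 d
          X = pow F x d

        closedForm-zero-suc : ∀ d → closedForm 0 (suc d) ≈ closedForm 0 d * (x + pow F q (suc d) * r * x)
        closedForm-zero-suc d = begin
          closedForm 0 (suc d)
            ≈⟨ closedForm-zero (suc d) ⟩
          prodFrom F 1+qⁱr 1 (suc d) * (x * X)
            ≈⟨ *-congʳ (prodFrom-snoc 1+qⁱr 1 d) ⟩
          P * (1# + Q * r) * (x * X)
            ≈⟨ solve 5 (λ P Q r x X → P :* (con 1 :+ Q :* r) :* (x :* X) := P :* X :* (x :+ Q :* r :* x))
                 ≈-refl P Q r x X ⟩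
          P * X * (x + Q * r * x)
            ≈⟨ *-congʳ (sym (closedForm-zero d)) ⟩
          closedForm 0 d * (x + Q * r * x) ∎
          where
          P = prodFrom F 1+qⁱr 1 d
          X = pow F x d
          Q = pow F q (suc d)

        closedForm-suc-zero : ∀ k → closedForm (suc k) 0 ≈ closedForm k 0 * (pow F q (suc (k ℕ.+ k ℕ.+ 0)) * s)
        closedForm-suc-zero k = begin
          pow F q (suc k ℕ.* suc k) * [ suc k ℕ.+ 0 choose suc k ] * 1# * (s * S) * 1#
            ≈⟨ *-congʳ (*-congʳ (*-congʳ (*-cong (pow-suc-square q k) (qbinom-diag (suc k))))) ⟩
          G * E * 1# * 1# * (s * S) * 1#
            ≈⟨ solve 4 (λ G E s S → G :* E :* con 1 :* con 1 :* (s :* S) :* con 1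
                                       := G :* con 1 :* con 1 :* S :* con 1 :* (E :* s)) ≈-refl G E s S ⟩
          G * 1# * 1# * S * 1# * (E * s)
            ≈⟨ *-cong (*-congʳ (*-congʳ (*-congʳ (*-congˡ (sym (qbinom-diag k))))))
                      (*-congʳ (reflexive (cong (λ m → pow F q (suc m)) (≡.sym (ℕₚ.+-identityʳ (k ℕ.+ k)))))) ⟩
          closedForm k 0 * (pow F q (suc (k ℕ.+ k ℕ.+ 0)) * s) ∎
          where
          G = pow F q (k ℕ.* k)
          E = pow F q (suc (k ℕ.+ k))
          S = pow F s k

        closedForm-suc-suc : ∀ k d → closedForm (suc k) (suc d) ≈
          closedForm (suc k) d * (x + pow F q (suc (suc (k ℕ.+ k ℕ.+ suc d))) * r * x)
            + closedForm k (suc d) * (pow F q (suc (k ℕ.+ k ℕ.+ suc d)) * s)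
        closedForm-suc-suc k d = begin
          closedForm K D
            ≈⟨ *-congʳ (*-congʳ (*-cong (*-congʳ (pow-suc-square q k))
                 (trans (prodFrom-snoc 1+qⁱr (suc K) d) (*-congˡ (+-congˡ (*-congʳ qᴷ⁺ᴰ)))))) ⟩
          G * E * B₁ * (P * (1# + QK * QD * r)) * (s * S) * (x * X)
            ≈⟨ solve 11 (λ G E B₁ P QK QD r s S x X →
                   G :* E :* B₁ :* (P :* (con 1 :+ QK :* QD :* r)) :* (s :* S) :* (x :* X)
                     := G :* E :* P :* s :* S :* x :* X :* (B₁ :+ QK :* QD :* r :* B₁))
                 ≈-refl G E B₁ P QK QD r s S x X ⟩
          G * E * P * s * S * x * X * (B₁ + QK * QD * r * B₁)
            ≈⟨ *-congˡ (+-cong pascalʳ (*-congˡ pascalˡ)) ⟩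
          G * E * P * s * S * x * X * ((B₃ * QD + B₂ * 1#) + QK * QD * r * (B₃ * 1# + B₂ * QK))
            ≈⟨ solve 12 (λ G E P s S x X B₂ B₃ QK QD r →
                   G :* E :* P :* s :* S :* x :* X
                     :* ((B₃ :* QD :+ B₂ :* con 1) :+ QK :* QD :* r :* (B₃ :* con 1 :+ B₂ :* QK))
                     := G :* E :* B₂ :* P :* (s :* S) :* X :* (x :+ QK :* QK :* QD :* r :* x)
                        :+ G :* B₃ :* ((con 1 :+ QK :* r) :* P) :* S :* (x :* X) :* (E :* QD :* s))
                 ≈-refl G E P s S x X B₂ B₃ QK QD r ⟩
          G * E * B₂ * P * (s * S) * X * (x + QK * QK * QD * r * x)
            + G * B₃ * ((1# + QK * r) * P) * S * (x * X) * (E * QD * s)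
            ≈⟨ sym (+-cong (*-cong (*-congʳ (*-congʳ (*-congʳ (*-congʳ (pow-suc-square q k)))))
                                   (+-congˡ (*-congʳ (*-congʳ q²ᴷ⁺ᴰ))))
                           (*-congˡ (*-congʳ (pow-+ q (suc (k ℕ.+ k)) D)))) ⟩
          closedForm K d * (x + pow F q (suc (suc (k ℕ.+ k ℕ.+ D))) * r * x)
            + closedForm k D * (pow F q (suc (k ℕ.+ k ℕ.+ D)) * s) ∎
          where
          K = suc k
          D = suc d
          G = pow F q (k ℕ.* k)
          E = pow F q (suc (k ℕ.+ k))
          QK = pow F q K
          QD = pow F q D
          B₁ = [ K ℕ.+ D choose K ]
          B₂ = [ K ℕ.+ d choose K ]
          B₃ = [ k ℕ.+ D choose k ]
          P = prodFrom F 1+qⁱr (suc K) d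
          S = pow F s k
          X = pow F x d
          qᴷ⁺ᴰ : pow F q (suc K ℕ.+ d) ≈ QK * QD
          qᴷ⁺ᴰ = trans (reflexive (cong (pow F q) (≡.sym (ℕₚ.+-suc K d)))) (pow-+ q K D)
          q²ᴷ⁺ᴰ : pow F q (suc (suc (k ℕ.+ k ℕ.+ D))) ≈ QK * QK * QD
          q²ᴷ⁺ᴰ = trans (reflexive (cong (pow F q) (≡.sym (suc-k+suc-k+d k D))))
                        (trans (pow-+ q (K ℕ.+ K) D) (*-congʳ (pow-+ q K K)))
          pascalˡ : B₁ ≈ B₃ * 1# + B₂ * QK
          pascalˡ = qbinom-pascal k d 1# QK
            (trans (+-cong (*-identityʳ _) (*-comm _ _)) (sym (qint-+ K D)))
          pascalʳ : B₁ ≈ B₃ * QD + B₂ * 1#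
          pascalʳ = qbinom-pascal k d QD 1#
            (trans (+-cong (*-comm _ _) (*-identityʳ _))
                   (trans (+-comm _ _) (trans (sym (qint-+ D K)) (reflexive (cong [_] (ℕₚ.+-comm D K))))))

        u-closedForm : ∀ k d → u F q r s x (k ℕ.+ k ℕ.+ d) k ≈ closedForm k d
        u-closedForm zero zero = trans (+-identityʳ 1#) (sym (trans (closedForm-zero 0) (*-identityˡ 1#)))
        u-closedForm zero (suc d) =
          trans (u-suc-zero r s x d) (trans (*-congʳ (u-closedForm 0 d)) (sym (closedForm-zero-suc d)))
        u-closedForm (suc k) zero = begin
          U (suc k ℕ.+ suc k ℕ.+ 0) (suc k)
            ≡⟨ cong (λ m → U m (suc k)) (suc-k+suc-k+d k 0) ⟩
          U (suc (suc n)) (suc k)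
            ≈⟨ u-suc-suc r s x n k ⟩
          U (suc n) (suc k) * A + U n k * B
            ≈⟨ +-cong (*-congʳ (u-vanishes r s x suc-n<k+k)) (*-congʳ (u-closedForm k 0)) ⟩
          0# * A + closedForm k 0 * B
            ≈⟨ trans (+-congʳ (zeroˡ A)) (+-identityˡ _) ⟩
          closedForm k 0 * B
            ≈⟨ sym (closedForm-suc-zero k) ⟩
          closedForm (suc k) 0 ∎
          where
          U = u F q r s x
          n = k ℕ.+ k ℕ.+ 0
          A = x + pow F q (suc (suc n)) * r * x
          B = pow F q (suc n) * s
          suc-n<k+k : suc n < suc k ℕ.+ suc k
          suc-n<k+k = ℕₚ.≤-reflexive (≡.sym (≡.trans (≡.sym (ℕₚ.+-identityʳ _)) (suc-k+suc-k+d k 0)))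
        u-closedForm (suc k) (suc d) = begin
          U (suc k ℕ.+ suc k ℕ.+ suc d) (suc k)
            ≡⟨ cong (λ m → U m (suc k)) (suc-k+suc-k+d k (suc d)) ⟩
          U (suc (suc n)) (suc k)
            ≈⟨ u-suc-suc r s x n k ⟩
          U (suc n) (suc k) * A + U n k * B
            ≡⟨ cong (λ m → U m (suc k) * A + U n k * B) suc-n≡ ⟩
          U (suc k ℕ.+ suc k ℕ.+ d) (suc k) * A + U n k * B
            ≈⟨ +-cong (*-congʳ (u-closedForm (suc k) d)) (*-congʳ (u-closedForm k (suc d))) ⟩
          closedForm (suc k) d * A + closedForm k (suc d) * B
            ≈⟨ sym (closedForm-suc-suc k d) ⟩
          closedForm (suc k) (suc d) ∎
          where
          U = u F q r s x
          n = k ℕ.+ k ℕ.+ suc d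
          A = x + pow F q (suc (suc n)) * r * x
          B = pow F q (suc n) * s
          suc-n≡ : suc n ≡ suc k ℕ.+ suc k ℕ.+ d
          suc-n≡ = ≡.trans (cong suc (ℕₚ.+-suc (k ℕ.+ k) d)) (≡.sym (suc-k+suc-k+d k d))

        formula : ℕ → ℕ → Carrier
        formula n k = pow F q (k ℕ.* k) * [ n ∸ k choose k ] * prodFrom F 1+qⁱr (suc k) (n ∸ k ∸ k)
                        * pow F s k * pow F x (n ∸ k ∸ k)

        closedForm≡formula : ∀ k d → closedForm k d ≡ formula (k ℕ.+ k ℕ.+ d) k
        closedForm≡formula k d rewrite ℕₚ.+-assoc k k d | ℕₚ.m+n∸m≡n k (k ℕ.+ d) | ℕₚ.m+n∸m≡n k d = refl

        u-formula : ∀ {n k} → k ℕ.+ k ≤ n → u F q r s x n k ≈ formula n k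
        u-formula {n} {k} k+k≤n = subst (λ m → u F q r s x m k ≈ formula m k) (ℕₚ.m+[n∸m]≡n k+k≤n)
          (trans (u-closedForm k (n ∸ (k ℕ.+ k))) (reflexive (closedForm≡formula k (n ∸ (k ℕ.+ k)))))

theorem2p2 : ∀ {c ℓ₁ ℓ₂} (F : HeytingField c ℓ₁ ℓ₂) → let open HeytingField F in
    (q r s x : Carrier) →
    q # (- 1#) →
    (nz : ∀ m → qint F q (suc m) # 0#) →
    (n k : ℕ) → 1 ≤ n →
    (k ≤ ⌊ n /2⌋ →
       u F q r s x n k ≈
         pow F q (k ℕ.* k) * qbinom F q nz (n ∸ k) k
           * prodFrom F (λ i → 1# + pow F q i * r) (suc k) (n ∸ k ∸ k)
           * pow F s k * pow F x (n ∸ k ∸ k))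
    × (⌊ n /2⌋ < k → u F q r s x n k ≈ 0#)
theorem2p2 F q r s x _ nz n k _ =
  (λ k≤⌊n/2⌋ → u-formula F q nz r s x (k≤⌊n/2⌋⇒k+k≤n k≤⌊n/2⌋)) ,
  (λ ⌊n/2⌋<k → u-vanishes F q r s x (⌊n/2⌋<k⇒n<k+k ⌊n/2⌋<k))
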